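{- Let $A$ be a $(0,1)$-matrix of order $n$, let $k\ge1$ and $s\ge0$ with $2k+s=n$, and let $B=U_{k,s}^*AU_{k,s}$. If every entry of $B$ belongs to $\{0,1,i,-i\}$, then $A=B$.
   Context: Let $U_0=\frac{1}{1+i}\begin{pmatrix}1&i\\ i&1\end{pmatrix}$, and for $k\ge1$, $s\ge0$ let $U_{k,s}$ be the block diagonal matrix of order $2k+s$ with $k$ diagonal blocks equal to $U_0$ followed by the identity matrix $I_s$. $U^*$ denotes the conjugate transpose. -}

module Defs where

open import Data.Nat as ℕ using (ℕ; zero; suc; _<ᵇ_; _≡ᵇ_)
open import Data.Nat.DivMod using (_/_; _%_)
open import Data.Bool using (Bool; true; false; if_then_else_; _∧_)
open import Data.Fin using (Fin; toℕ)
open import Data.Rational as ℚ using (ℚ; 0ℚ; 1ℚ; ½; -½)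

-- Gaussian rationals  Q(i) ⊆ ℂ : a + b i  (all entries involved lie in Q(i))
record GQ : Set where
  constructor _+i_
  field
    re : ℚ
    im : ℚ
open GQ public

infixl 6 _⊕_
infixl 7 _⊗_

_⊕_ : GQ → GQ → GQ
(a +i b) ⊕ (c +i d) = (a ℚ.+ c) +i (b ℚ.+ d)

_⊗_ : GQ → GQ → GQ
(a +i b) ⊗ (c +i d) = ((a ℚ.* c) ℚ.- (b ℚ.* d)) +i ((a ℚ.* d) ℚ.+ (b ℚ.* c))

conj : GQ → GQ
conj (a +i b) = a +i (ℚ.- b)

𝟘 𝟙 𝕚 -𝕚 : GQ
𝟘 = 0ℚ +i 0ℚ
𝟙 = 1ℚ +i 0ℚ
𝕚 = 0ℚ +i 1ℚ
-𝕚 = 0ℚ +i (ℚ.- 1ℚ)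

-- 1/(1+i) = 1/2 - (1/2) i
inv1+i : GQ
inv1+i = ½ +i -½

Mat : ℕ → Set
Mat n = Fin n → Fin n → GQ

sumFin : {n : ℕ} → (Fin n → GQ) → GQ
sumFin {zero} f = 𝟘
sumFin {suc n} f = f Fin.zero ⊕ sumFin (λ i → f (Fin.suc i))
  where import Data.Fin as Fin

_·_ : {n : ℕ} → Mat n → Mat n → Mat n
(M · N) i j = sumFin (λ l → M i l ⊗ N l j)

_* : {n : ℕ} → Mat n → Mat n
(M *) i j = conj (M j i)

U₀ : ℕ → ℕ → GQ
U₀ i j = inv1+i ⊗ (if i ≡ᵇ j then 𝟙 else 𝕚)

-- entry (i,j) of U_{k,s} = diag(U₀,…,U₀ (k times), I_s), by 0-based indices
Ukℕ : ℕ → ℕ → ℕ → GQ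
Ukℕ k i j =
  if (i <ᵇ 2 ℕ.* k) ∧ (j <ᵇ 2 ℕ.* k)
  then (if (i / 2) ≡ᵇ (j / 2) then U₀ (i % 2) (j % 2) else 𝟘)
  else (if (i <ᵇ 2 ℕ.* k) ∨ (j <ᵇ 2 ℕ.* k) then 𝟘 else (if i ≡ᵇ j then 𝟙 else 𝟘))
  where open import Data.Bool using (_∨_)

-- U_{k,s} as a matrix of order n (used with n = 2k + s)
U : (k n : ℕ) → Mat n
U k n i j = Ukℕ k (toℕ i) (toℕ j)

{-# OPTIONS --safe #-}
-- U is block diagonal, so column c of U vanishes outside two distinct rows, on which it is a
-- column of U₀ (c inside a block) or of I₂ (c in the identity part, paired with row 0, which
-- differs from c because k ≥ 1).  Hence B i j is the entry at the same position of V* M W,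
-- where M is a 2×2 submatrix of A containing A i j and V, W ∈ {U₀, I₂}.  For M = [[a,b],[c,d]]
-- the entries of U₀* M U₀ are ½(a + d ± i(b − c)) and ½(b + c ± i(a − d)); for a (0,1)-matrix
-- these lie in {0, 1, i, −i} only if a = d and b = c, i.e. only if they equal the entries of M.
-- The finitely many cases are decided by evaluation.
module Submission where

open import Defs
open import Data.Bool using (Bool; true; false; T)
open import Data.Bool.Properties using (T-≡)
open import Data.Empty using (⊥-elim)
open import Data.Fin using (Fin; zero; suc; toℕ; fromℕ<)
open import Data.Fin.Properties using (suc-injective; toℕ-injective; toℕ-fromℕ<; toℕ<n; all?)
open import Data.Nat using (ℕ; zero; suc; _+_; _*_; _<_; _≤_; _≥_; _<ᵇ_; _≡ᵇ_)
open import Data.Nat.DivMod using (_/_; _%_; _mod_; _divMod_; DivMod; m*n/n≡m; m<n⇒m/n≡0; [m+kn]%n≡m%n; m<n⇒m%n≡m; +-distrib-/-∣ʳ; m<n*o⇒m/o<n)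
open import Data.Nat.Divisibility using (n∣m*n)
open import Data.Nat.Properties using (<⇒<ᵇ; <ᵇ⇒<; ≡⇒≡ᵇ; ≡ᵇ⇒≡; ≤⇒≯; ≮⇒≥; _<?_; m≤m+n; ≤-trans; +-monoˡ-<; *-monoˡ-≤; *-comm; module ≤-Reasoning)
open import Data.Product using (∃; _,_; _×_; proj₁; proj₂; uncurry)
open import Data.Sum using (_⊎_; inj₁; inj₂)
import Data.Rational.Properties as ℚ
open import Function using (_∘_)
open import Function.Bundles using (Equivalence)
open import Relation.Binary.Definitions using (DecidableEquality)
open import Relation.Binary.PropositionalEquality using (_≡_; _≢_; refl; sym; trans; cong; cong₂; subst; module ≡-Reasoning)
open import Relation.Nullary using (¬_; Dec; yes; no)
open import Relation.Nullary.Decidable using (map′; from-yes; _×-dec_; _⊎-dec_; _→-dec_)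
open import Relation.Unary using (Decidable)

pattern one = suc zero

⊕-identityˡ : ∀ x → 𝟘 ⊕ x ≡ x
⊕-identityˡ (a +i b) = cong₂ _+i_ (ℚ.+-identityˡ a) (ℚ.+-identityˡ b)

⊕-identityʳ : ∀ x → x ⊕ 𝟘 ≡ x
⊕-identityʳ (a +i b) = cong₂ _+i_ (ℚ.+-identityʳ a) (ℚ.+-identityʳ b)

⊕-comm : ∀ x y → x ⊕ y ≡ y ⊕ x
⊕-comm (a +i b) (c +i d) = cong₂ _+i_ (ℚ.+-comm a c) (ℚ.+-comm b d)

⊗-zeroˡ : ∀ x → 𝟘 ⊗ x ≡ 𝟘
⊗-zeroˡ (a +i b) rewrite ℚ.*-zeroˡ a | ℚ.*-zeroˡ b = refl

⊗-zeroʳ : ∀ x → x ⊗ 𝟘 ≡ 𝟘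
⊗-zeroʳ (a +i b) rewrite ℚ.*-zeroʳ a | ℚ.*-zeroʳ b = refl

_≟_ : DecidableEquality GQ
(a +i b) ≟ (c +i d) =
  map′ (uncurry (cong₂ _+i_)) (λ e → cong re e , cong im e) ((a ℚ.≟ c) ×-dec (b ℚ.≟ d))

sumFin-cong : ∀ {n} {f g : Fin n → GQ} → (∀ l → f l ≡ g l) → sumFin f ≡ sumFin g
sumFin-cong {zero}  f≗g = refl
sumFin-cong {suc n} f≗g = cong₂ _⊕_ (f≗g zero) (sumFin-cong (f≗g ∘ suc))

sumFin-zero : ∀ {n} (f : Fin n → GQ) → (∀ l → f l ≡ 𝟘) → sumFin f ≡ 𝟘
sumFin-zero {zero}  f f≡0 = refl
sumFin-zero {suc n} f f≡0 = trans (cong₂ _⊕_ (f≡0 zero) (sumFin-zero (f ∘ suc) (f≡0 ∘ suc))) (⊕-identityʳ 𝟘)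

sumFin-single : ∀ {n} (f : Fin n → GQ) (p : Fin n) → (∀ l → l ≢ p → f l ≡ 𝟘) → sumFin f ≡ f p
sumFin-single {suc n} f zero    f≡0 =
  trans (cong (f zero ⊕_) (sumFin-zero (f ∘ suc) (λ l → f≡0 (suc l) λ ()))) (⊕-identityʳ _)
sumFin-single {suc n} f (suc p) f≡0 =
  trans (cong₂ _⊕_ (f≡0 zero λ ()) (sumFin-single (f ∘ suc) p (λ l l≢p → f≡0 (suc l) (l≢p ∘ suc-injective))))
        (⊕-identityˡ _)

sumFin-pair : ∀ {n} (f : Fin n → GQ) (p q : Fin n) → p ≢ q → (∀ l → l ≢ p → l ≢ q → f l ≡ 𝟘)
            → sumFin f ≡ f p ⊕ f q
sumFin-pair {suc n} f zero    zero    p≢q f≡0 = ⊥-elim (p≢q refl)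
sumFin-pair {suc n} f zero    (suc q) p≢q f≡0 =
  cong (f zero ⊕_) (sumFin-single (f ∘ suc) q (λ l l≢q → f≡0 (suc l) (λ ()) (l≢q ∘ suc-injective)))
sumFin-pair {suc n} f (suc p) zero    p≢q f≡0 =
  trans (cong (f zero ⊕_) (sumFin-single (f ∘ suc) p (λ l l≢p → f≡0 (suc l) (l≢p ∘ suc-injective) (λ ()))))
        (⊕-comm (f zero) (f (suc p)))
sumFin-pair {suc n} f (suc p) (suc q) p≢q f≡0 =
  trans (cong₂ _⊕_ (f≡0 zero (λ ()) (λ ()))
                   (sumFin-pair (f ∘ suc) p q (p≢q ∘ cong suc)
                                (λ l l≢p l≢q → f≡0 (suc l) (l≢p ∘ suc-injective) (l≢q ∘ suc-injective))))
        (⊕-identityˡ _)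

T⇒≡true : ∀ {b} → T b → b ≡ true
T⇒≡true = Equivalence.to T-≡

¬T⇒≡false : ∀ {b} → ¬ T b → b ≡ false
¬T⇒≡false {false} _  = refl
¬T⇒≡false {true}  ¬t = ⊥-elim (¬t _)

module _ (k : ℕ) where

  private
    <ᵇ-true : ∀ {x y} → x < y → (x <ᵇ y) ≡ true
    <ᵇ-true = T⇒≡true ∘ <⇒<ᵇ

    <ᵇ-false : ∀ {x y} → y ≤ x → (x <ᵇ y) ≡ false
    <ᵇ-false {x} {y} y≤x = ¬T⇒≡false (≤⇒≯ y≤x ∘ <ᵇ⇒< x y)

    ≡ᵇ-refl : ∀ x → (x ≡ᵇ x) ≡ true
    ≡ᵇ-refl x = T⇒≡true (≡⇒≡ᵇ x x refl)

    ≡ᵇ-false : ∀ {x y} → x ≢ y → (x ≡ᵇ y) ≡ false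
    ≡ᵇ-false {x} {y} x≢y = ¬T⇒≡false (x≢y ∘ ≡ᵇ⇒≡ x y)

  Ukℕ-diagonalBlock : ∀ {x y} → x < 2 * k → y < 2 * k → x / 2 ≡ y / 2 → Ukℕ k x y ≡ U₀ (x % 2) (y % 2)
  Ukℕ-diagonalBlock {x} {y} x<2k y<2k x≈y
    rewrite <ᵇ-true x<2k | <ᵇ-true y<2k | x≈y | ≡ᵇ-refl (y / 2) = refl

  Ukℕ-offDiagonalBlock : ∀ {x y} → x < 2 * k → y < 2 * k → x / 2 ≢ y / 2 → Ukℕ k x y ≡ 𝟘
  Ukℕ-offDiagonalBlock x<2k y<2k x≉y rewrite <ᵇ-true x<2k | <ᵇ-true y<2k | ≡ᵇ-false x≉y = refl

  Ukℕ-corner : ∀ {x y} → x < 2 * k → 2 * k ≤ y → Ukℕ k x y ≡ 𝟘 × Ukℕ k y x ≡ 𝟘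
  Ukℕ-corner x<2k 2k≤y rewrite <ᵇ-true x<2k | <ᵇ-false 2k≤y = refl , refl

  Ukℕ-identityDiagonal : ∀ {x} → 2 * k ≤ x → Ukℕ k x x ≡ 𝟙
  Ukℕ-identityDiagonal {x} 2k≤x rewrite <ᵇ-false 2k≤x | ≡ᵇ-refl x = refl

  Ukℕ-identityOffDiagonal : ∀ {x y} → 2 * k ≤ x → 2 * k ≤ y → x ≢ y → Ukℕ k x y ≡ 𝟘
  Ukℕ-identityOffDiagonal 2k≤x 2k≤y x≢y rewrite <ᵇ-false 2k≤x | <ᵇ-false 2k≤y | ≡ᵇ-false x≢y = refl

blockMember : ℕ → Fin 2 → ℕ
blockMember p a = toℕ a + p * 2

blockMember-/ : ∀ p a → blockMember p a / 2 ≡ p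
blockMember-/ p a = begin
  (toℕ a + p * 2) / 2    ≡⟨ +-distrib-/-∣ʳ (toℕ a) (n∣m*n p) ⟩
  toℕ a / 2 + p * 2 / 2  ≡⟨ cong₂ _+_ (m<n⇒m/n≡0 (toℕ<n a)) (m*n/n≡m p 2) ⟩
  p                      ∎
  where open ≡-Reasoning

blockMember-% : ∀ p a → blockMember p a % 2 ≡ toℕ a
blockMember-% p a = trans ([m+kn]%n≡m%n (toℕ a) p 2) (m<n⇒m%n≡m (toℕ<n a))

blockMember-injective : ∀ p {a b} → blockMember p a ≡ blockMember p b → a ≡ b
blockMember-injective p {a} {b} e =
  toℕ-injective (trans (sym (blockMember-% p a)) (trans (cong (_% 2) e) (blockMember-% p b)))

blockMember-< : ∀ {p k} a → p < k → blockMember p a < 2 * k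
blockMember-< {p} {k} a p<k = begin-strict
  toℕ a + p * 2  <⟨ +-monoˡ-< (p * 2) (toℕ<n a) ⟩
  suc p * 2      ≤⟨ *-monoˡ-≤ 2 p<k ⟩
  k * 2          ≡⟨ *-comm k 2 ⟩
  2 * k          ∎
  where open ≤-Reasoning

blockMember-divMod : ∀ x → x ≡ blockMember (x / 2) (x mod 2)
blockMember-divMod x = DivMod.property (x divMod 2)

-- U 1 2 is U₀ and U 0 2 is I₂.
model : Bool → Mat 2
model true  = U 1 2
model false = U 0 2

model-block : ∀ a b → model true a b ≡ U₀ (toℕ a) (toℕ b)
model-block zero zero = refl
model-block zero one  = refl
model-block one  zero = refl
model-block one  one  = refl

record Window (k n : ℕ) (c : Fin n) : Set where
  field
    inBlock        : Bool
    index          : Fin 2 → Fin n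
    index-distinct : index zero ≢ index one
    position       : Fin 2
    index-position : index position ≡ c
    on-window      : ∀ a → U k n (index a) c ≡ model inBlock a position
    off-window     : ∀ l → l ≢ index zero → l ≢ index one → U k n l c ≡ 𝟘

open Window

blockWindow : ∀ {k n} → 2 * k ≤ n → (c : Fin n) → toℕ c < 2 * k → Window k n c
blockWindow {k} {n} 2k≤n c c<2k = record
  { inBlock        = true
  ; index          = ι
  ; index-distinct = ι-distinct
  ; position       = toℕ c mod 2
  ; index-position = toℕ-injective (trans (toℕ-ι (toℕ c mod 2)) (sym (blockMember-divMod (toℕ c))))
  ; on-window      = on-window′
  ; off-window     = off-window′
  }
  where
  p : ℕ
  p = toℕ c / 2

  member<2k : ∀ a → blockMember p a < 2 * k
  member<2k a = blockMember-< a (m<n*o⇒m/o<n {n = k} (subst (toℕ c <_) (*-comm 2 k) c<2k))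

  ι : Fin 2 → Fin n
  ι a = fromℕ< (≤-trans (member<2k a) 2k≤n)

  toℕ-ι : ∀ a → toℕ (ι a) ≡ blockMember p a
  toℕ-ι a = toℕ-fromℕ< _

  ι-distinct : ι zero ≢ ι one
  ι-distinct e with blockMember-injective p {zero} {one} (trans (sym (toℕ-ι zero)) (trans (cong toℕ e) (toℕ-ι one)))
  ... | ()

  on-window′ : ∀ a → U k n (ι a) c ≡ model true a (toℕ c mod 2)
  on-window′ a = begin
    Ukℕ k (toℕ (ι a)) (toℕ c)              ≡⟨ cong (λ x → Ukℕ k x (toℕ c)) (toℕ-ι a) ⟩
    Ukℕ k (blockMember p a) (toℕ c)        ≡⟨ Ukℕ-diagonalBlock k (member<2k a) c<2k (blockMember-/ p a) ⟩
    U₀ (blockMember p a % 2) (toℕ c % 2)   ≡⟨ cong₂ U₀ (blockMember-% p a) (sym (toℕ-fromℕ< _)) ⟩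
    U₀ (toℕ a) (toℕ (toℕ c mod 2))         ≡⟨ sym (model-block a (toℕ c mod 2)) ⟩
    model true a (toℕ c mod 2)             ∎
    where open ≡-Reasoning

  off-window′ : ∀ l → l ≢ ι zero → l ≢ ι one → U k n l c ≡ 𝟘
  off-window′ l l≢ι0 l≢ι1 with toℕ l <? 2 * k
  ... | no  l≮2k = proj₂ (Ukℕ-corner k c<2k (≮⇒≥ l≮2k))
  ... | yes l<2k = Ukℕ-offDiagonalBlock k l<2k c<2k l-outside
    where
    ι-avoid : ∀ a → l ≢ ι a
    ι-avoid zero = l≢ι0
    ι-avoid one  = l≢ι1

    l-outside : toℕ l / 2 ≢ p
    l-outside e = ι-avoid (toℕ l mod 2) (toℕ-injective (begin
      toℕ l                                   ≡⟨ blockMember-divMod (toℕ l) ⟩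
      blockMember (toℕ l / 2) (toℕ l mod 2)   ≡⟨ cong (λ q → blockMember q (toℕ l mod 2)) e ⟩
      blockMember p (toℕ l mod 2)             ≡⟨ sym (toℕ-ι (toℕ l mod 2)) ⟩
      toℕ (ι (toℕ l mod 2))                   ∎))
      where open ≡-Reasoning

identityWindow : ∀ {k n} → 1 ≤ k → (c : Fin n) → 2 * k ≤ toℕ c → Window k n c
identityWindow {k} {suc n} k≥1 c 2k≤c = record
  { inBlock        = false
  ; index          = ι
  ; index-distinct = c≢0
  ; position       = zero
  ; index-position = refl
  ; on-window      = on-window′
  ; off-window     = off-window′
  }
  where
  0<2k : 0 < 2 * k
  0<2k = ≤-trans k≥1 (m≤m+n k (k + 0))

  ι : Fin 2 → Fin (suc n)
  ι zero = c
  ι one  = zero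

  c≢0 : c ≢ zero
  c≢0 refl = ≤⇒≯ 2k≤c 0<2k

  on-window′ : ∀ a → U k (suc n) (ι a) c ≡ model false a zero
  on-window′ zero = Ukℕ-identityDiagonal k 2k≤c
  on-window′ one  = proj₁ (Ukℕ-corner k 0<2k 2k≤c)

  off-window′ : ∀ l → l ≢ c → l ≢ zero → U k (suc n) l c ≡ 𝟘
  off-window′ l l≢c _ with toℕ l <? 2 * k
  ... | yes l<2k = proj₁ (Ukℕ-corner k l<2k 2k≤c)
  ... | no  l≮2k = Ukℕ-identityOffDiagonal k (≮⇒≥ l≮2k) 2k≤c (l≢c ∘ toℕ-injective)

window : ∀ {k n} → 1 ≤ k → 2 * k ≤ n → (c : Fin n) → Window k n c
window {k} k≥1 2k≤n c with toℕ c <? 2 * k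
... | yes c<2k = blockWindow 2k≤n c c<2k
... | no  c≮2k = identityWindow k≥1 c (≮⇒≥ c≮2k)

sumFin-window : ∀ {k n c} (w : Window k n c) (f : Fin n → GQ → GQ) → (∀ l → f l 𝟘 ≡ 𝟘)
              → sumFin (λ l → f l (U k n l c)) ≡ sumFin (λ a → f (index w a) (model (inBlock w) a (position w)))
sumFin-window {k} {n} {c} w f f-zero = begin
  sumFin (λ l → f l (U k n l c))
    ≡⟨ sumFin-pair _ (ι zero) (ι one) (index-distinct w)
                   (λ l l≢ι0 l≢ι1 → trans (cong (f l) (off-window w l l≢ι0 l≢ι1)) (f-zero l)) ⟩
  f (ι zero) (U k n (ι zero) c) ⊕ f (ι one) (U k n (ι one) c)
    ≡⟨ cong₂ _⊕_ (cong (f (ι zero)) (on-window w zero)) (cong (f (ι one)) (on-window w one)) ⟩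
  f (ι zero) (V zero) ⊕ f (ι one) (V one)
    ≡⟨ cong (f (ι zero) (V zero) ⊕_) (sym (⊕-identityʳ _)) ⟩
  sumFin (λ a → f (ι a) (V a))
    ∎
  where
  open ≡-Reasoning
  ι : Fin 2 → Fin n
  ι = index w
  V : Fin 2 → GQ
  V a = model (inBlock w) a (position w)

conjugate : Bool → Bool → Mat 2 → Mat 2
conjugate b b′ M = ((model b *) · M) · model b′

conjugate-window : ∀ {k n i j} (σ : Window k n i) (τ : Window k n j) (A : Mat n)
                 → (((U k n *) · A) · U k n) i j
                   ≡ conjugate (inBlock σ) (inBlock τ) (λ a b → A (index σ a) (index τ b)) (position σ) (position τ)
conjugate-window {k} {n} {i} {j} σ τ A = begin
  sumFin (λ m → row m ⊗ U k n m j)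
    ≡⟨ sumFin-window τ (λ m w → row m ⊗ w) (λ m → ⊗-zeroʳ (row m)) ⟩
  sumFin (λ b → row (index τ b) ⊗ model (inBlock τ) b (position τ))
    ≡⟨ sumFin-cong (λ b → cong (_⊗ model (inBlock τ) b (position τ))
                               (sumFin-window σ (λ l u → conj u ⊗ A l (index τ b)) (λ l → ⊗-zeroˡ (A l (index τ b))))) ⟩
  conjugate (inBlock σ) (inBlock τ) (λ a b → A (index σ a) (index τ b)) (position σ) (position τ)
    ∎
  where
  open ≡-Reasoning
  row : Fin n → GQ
  row m = sumFin (λ l → conj (U k n l i) ⊗ A l m)

Is01 : GQ → Set
Is01 x = x ≡ 𝟘 ⊎ x ≡ 𝟙

Is01±i : GQ → Set
Is01±i x = x ≡ 𝟘 ⊎ x ≡ 𝟙 ⊎ x ≡ 𝕚 ⊎ x ≡ -𝕚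

is01±i? : Decidable Is01±i
is01±i? x = x ≟ 𝟘 ⊎-dec x ≟ 𝟙 ⊎-dec x ≟ 𝕚 ⊎-dec x ≟ -𝕚

bit : Bool → GQ
bit false = 𝟘
bit true  = 𝟙

Is01⇒bit : ∀ {x} → Is01 x → ∃ λ b → x ≡ bit b
Is01⇒bit (inj₁ x≡0) = false , x≡0
Is01⇒bit (inj₂ x≡1) = true , x≡1

∀-Bool? : ∀ {p} {P : Bool → Set p} → Decidable P → Dec (∀ b → P b)
∀-Bool? P? = map′ (λ (f , t) → λ { false → f ; true → t }) (λ h → h false , h true) (P? false ×-dec P? true)

matrix₂ : GQ → GQ → GQ → GQ → Mat 2
matrix₂ x₀₀ x₀₁ x₁₀ x₁₁ zero zero = x₀₀
matrix₂ x₀₀ x₀₁ x₁₀ x₁₁ zero one  = x₀₁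
matrix₂ x₀₀ x₀₁ x₁₀ x₁₁ one  zero = x₁₀
matrix₂ x₀₀ x₀₁ x₁₀ x₁₁ one  one  = x₁₁

matrix₂-η : (M : Mat 2) → ∀ a b → M a b ≡ matrix₂ (M zero zero) (M zero one) (M one zero) (M one one) a b
matrix₂-η M zero zero = refl
matrix₂-η M zero one  = refl
matrix₂-η M one  zero = refl
matrix₂-η M one  one  = refl

Rigid : Bool → Bool → Mat 2 → Set
Rigid b b′ M = ∀ r r′ → Is01±i (conjugate b b′ M r r′) → M r r′ ≡ conjugate b b′ M r r′

rigid-bits : ∀ b b′ x₀₀ x₀₁ x₁₀ x₁₁ → Rigid b b′ (matrix₂ (bit x₀₀) (bit x₀₁) (bit x₁₀) (bit x₁₁))
rigid-bits = from-yes
  (∀-Bool? λ b → ∀-Bool? λ b′ → ∀-Bool? λ x₀₀ → ∀-Bool? λ x₀₁ → ∀-Bool? λ x₁₀ → ∀-Bool? λ x₁₁ →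
   let M = matrix₂ (bit x₀₀) (bit x₀₁) (bit x₁₀) (bit x₁₁) in
   all? λ r → all? λ r′ → is01±i? (conjugate b b′ M r r′) →-dec (M r r′ ≟ conjugate b b′ M r r′))

rigid-01 : ∀ b b′ {x₀₀ x₀₁ x₁₀ x₁₁} → Is01 x₀₀ → Is01 x₀₁ → Is01 x₁₀ → Is01 x₁₁
         → Rigid b b′ (matrix₂ x₀₀ x₀₁ x₁₀ x₁₁)
rigid-01 b b′ h₀₀ h₀₁ h₁₀ h₁₁ with Is01⇒bit h₀₀ | Is01⇒bit h₀₁ | Is01⇒bit h₁₀ | Is01⇒bit h₁₁
... | x₀₀ , refl | x₀₁ , refl | x₁₀ , refl | x₁₁ , refl = rigid-bits b b′ x₀₀ x₀₁ x₁₀ x₁₁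

rigid : ∀ b b′ (M : Mat 2) → (∀ a c → Is01 (M a c)) → Rigid b b′ M
rigid b b′ M M-01 r r′ good =
  trans (matrix₂-η M r r′) (rigid-01 b b′ (M-01 zero zero) (M-01 zero one) (M-01 one zero) (M-01 one one) r r′ good)

lemma35 : (n k s : ℕ) → k ≥ 1 → 2 * k + s ≡ n → (A : Mat n)
    → (∀ i j → A i j ≡ 𝟘 ⊎ A i j ≡ 𝟙)
    → (∀ i j → (((U k n *) · A) · U k n) i j ≡ 𝟘 ⊎ (((U k n *) · A) · U k n) i j ≡ 𝟙
                ⊎ (((U k n *) · A) · U k n) i j ≡ 𝕚 ⊎ (((U k n *) · A) · U k n) i j ≡ -𝕚)
    → ∀ i j → A i j ≡ (((U k n *) · A) · U k n) i j
lemma35 n k s k≥1 2k+s≡n A A-01 B-01±i i j = begin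
  A i j                                                        ≡⟨ cong₂ A (sym (index-position σ)) (sym (index-position τ)) ⟩
  M (position σ) (position τ)                                  ≡⟨ rigid (inBlock σ) (inBlock τ) M (λ _ _ → A-01 _ _) _ _ B-local-01±i ⟩
  conjugate (inBlock σ) (inBlock τ) M (position σ) (position τ) ≡⟨ sym B-local ⟩
  (((U k n *) · A) · U k n) i j                                ∎
  where
  open ≡-Reasoning

  2k≤n : 2 * k ≤ n
  2k≤n = subst (2 * k ≤_) 2k+s≡n (m≤m+n (2 * k) s)

  σ : Window k n i
  σ = window k≥1 2k≤n i

  τ : Window k n j
  τ = window k≥1 2k≤n j

  M : Mat 2
  M a b = A (index σ a) (index τ b)

  B-local : (((U k n *) · A) · U k n) i j ≡ conjugate (inBlock σ) (inBlock τ) M (position σ) (position τ)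
  B-local = conjugate-window σ τ A

  B-local-01±i : Is01±i (conjugate (inBlock σ) (inBlock τ) M (position σ) (position τ))
  B-local-01±i = subst Is01±i B-local (B-01±i i j)
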